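{- For $n\ge1$ and $1\le k\le n$, $$d(n,k)=d(n-1,k-1)+\left\lceil\frac{n-1}{2}\right\rceil d(n-1,k),$$ and the boundary conditions $d(n,0)=\delta_{n,0}$, $d(n,n)=1$ for $n\ge0$, and $d(n,k)=0$ for $k>n$ hold.
   Context: The staircase board of length $n$ consists of squares $(i,j)$, $i,j\ge1$, $i+j\le n$ (row $i$ from the top, column $j$ from the left; column $j$ has $n-j$ squares). Square $(i,j)$ has $n-i-j$ squares below it in its column and is shaded if $n-i-j$ is even. $\mathcal{AR}(n,r)$ is the set of placements of $r$ rooks on shaded squares of the staircase board of length $n$ with no two rooks in the same column (the empty placement counts; the board of length $0$ or $1$ has no squares). $d(n,k)=|\mathcal{AR}(n,n-k)|$, understood as $0$ when $n-k<0$. -}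

module Defs where

open import Data.Nat using (ℕ; zero; suc; _+_; _∸_; _≤_; _<_; _≡ᵇ_; _%_)
open import Data.Bool using (Bool; true; false; _∧_)
import Data.Bool
open import Data.Maybe using (Maybe; just; nothing)
open import Data.List using (List; []; _∷_; map; filter; length; concatMap; upTo; applyUpTo)
open import Data.Nat.Properties using (_≟_)
open import Relation.Nullary.Decidable using (⌊_⌋)
open import Relation.Binary.PropositionalEquality using (_≡_)

-- A placement on the staircase board of length n is recorded column by
-- column, for columns j = 1, ..., n-1 (column j has n-j squares, rows
-- 1..n-j).  Each column holds either no rook ('nothing') or one rook in
-- row i ('just i').  Hence "no two rooks in the same column" is built in.
Placement : Set
Placement = List (Maybe ℕ)

shaded : ℕ → ℕ → ℕ → Bool
shaded n i j = (n ∸ i ∸ j) % 2 ≡ᵇ 0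

shadedRows : ℕ → ℕ → List ℕ
shadedRows n j = filter (λ i → shaded n i j Data.Bool.≟ true) (applyUpTo suc (n ∸ j))

columnChoices : ℕ → ℕ → List (Maybe ℕ)
columnChoices n j = nothing ∷ map just (shadedRows n j)

placementsFrom : ℕ → ℕ → ℕ → List Placement
placementsFrom n j zero = [] ∷ []
placementsFrom n j (suc m) =
  concatMap (λ c → map (c ∷_) (placementsFrom n (suc j) m)) (columnChoices n j)

allPlacements : ℕ → List Placement
allPlacements n = placementsFrom n 1 (n ∸ 1)

rookCount : Placement → ℕ
rookCount [] = 0
rookCount (nothing ∷ p) = rookCount p
rookCount (just _ ∷ p) = suc (rookCount p)

AR-card : ℕ → ℕ → ℕ
AR-card n r = length (filter (λ p → rookCount p ≟ r) (allPlacements n))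

d : ℕ → ℕ → ℕ
d n k with k Data.Nat.≤ᵇ n
... | true  = AR-card n (n ∸ k)
... | false = 0

ceilHalf : ℕ → ℕ
ceilHalf m = (suc m) Data.Nat./ 2

δ : ℕ → ℕ → ℕ
δ m n with m Data.Nat.≡ᵇ n
... | true = 1
... | false = 0

module Submission where

-- Deleting the first column of the staircase board of length
-- n+1 leaves exactly the staircase board of length n, with the same
-- shading (the shading of a square only depends on n - i - j).  The first
-- column has ⌈n/2⌉ shaded squares.  Splitting placements on the board of
-- length n+1 according to the content of column 1 therefore gives
--     |AR(n+1, r)| = |AR(n, r)| + ⌈n/2⌉ · |AR(n, r-1)|      (AR-step),
-- with the second summand read as 0 for r = 0.  The file establishes
--   * counting lemmas for placement lists built column by column,
--   * the shift identity (board n+1 from column j+1 = board n from column j),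
--   * the count of shaded squares in the first column,
-- which combine to AR-step.  From AR-step follow |AR(n,0)| = 1 and
-- |AR(n,r)| = 0 when r exceeds the number n-1 of columns.  Finally,
-- unfolding d(n,k) = |AR(n,n-k)| turns these into the recurrence and the
-- boundary conditions of Proposition 7.6.

open import Defs
open import Data.Nat using (ℕ; zero; suc; _+_; _*_; _∸_; _≤_; _<_; z≤n; s≤s; _%_; _≡ᵇ_; _≤ᵇ_)
open import Data.Nat.Properties
  using (_≟_; ≤-refl; ≤-trans; n≤1+n; +-suc; *-zeroʳ; n∸n≡0; ∸-+-assoc; +-∸-assoc;
         ≤⇒≤ᵇ; ≤ᵇ⇒≤; <⇒≱; m≤n⇒m<n∨m≡n)
open import Data.Nat.DivMod using (m/n≡1+[m∸n]/n)
open import Data.Product using (_×_; _,_)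
open import Data.Bool using (Bool; true; false; T)
import Data.Bool
open import Data.Maybe using (just; nothing)
open import Data.List using (List; []; _∷_; map; filter; length; applyUpTo; _++_; concat)
open import Data.List.Properties using (filter-++; length-++)
open import Data.Unit using (tt)
open import Data.Sum using (inj₁; inj₂)
open import Function using (_∘_)
open import Relation.Nullary using (does; contradiction)
open import Relation.Binary.PropositionalEquality

indicator : Bool → ℕ
indicator true  = 1
indicator false = 0

-- countTrue f m = #{ x < m | f x }, peeling off x = 0 first so that it
-- follows the recursion of 'applyUpTo'.
countTrue : (ℕ → Bool) → ℕ → ℕ
countTrue f zero    = 0
countTrue f (suc m) = indicator (f 0) + countTrue (f ∘ suc) m

length-filter-applyUpTo : ∀ (g : ℕ → Bool) (h : ℕ → ℕ) m →
  length (filter (λ i → g i Data.Bool.≟ true) (applyUpTo h m)) ≡ countTrue (g ∘ h) m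
length-filter-applyUpTo g h zero = refl
length-filter-applyUpTo g h (suc m) with g (h zero)
... | true  = cong suc (length-filter-applyUpTo g (h ∘ suc) m)
... | false = length-filter-applyUpTo g (h ∘ suc) m

ceilHalf-suc : ∀ a → indicator (a % 2 ≡ᵇ 0) + ceilHalf a ≡ ceilHalf (suc a)
ceilHalf-suc zero          = refl
ceilHalf-suc (suc zero)    = refl
ceilHalf-suc (suc (suc a)) = begin
    indicator (a % 2 ≡ᵇ 0) + (3 + a) Data.Nat./ 2
  ≡⟨ cong (indicator (a % 2 ≡ᵇ 0) +_) (m/n≡1+[m∸n]/n {3 + a} {2} (s≤s (s≤s z≤n))) ⟩
    indicator (a % 2 ≡ᵇ 0) + suc (ceilHalf a)
  ≡⟨ +-suc (indicator (a % 2 ≡ᵇ 0)) (ceilHalf a) ⟩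
    suc (indicator (a % 2 ≡ᵇ 0) + ceilHalf a)
  ≡⟨ cong suc (ceilHalf-suc a) ⟩
    suc (ceilHalf (suc a))
  ≡⟨ sym (m/n≡1+[m∸n]/n {4 + a} {2} (s≤s (s≤s z≤n))) ⟩
    (4 + a) Data.Nat./ 2
  ∎
  where open ≡-Reasoning

countTrue-even : ∀ a → countTrue (λ x → (a ∸ x ∸ 1) % 2 ≡ᵇ 0) a ≡ ceilHalf a
countTrue-even zero    = refl
countTrue-even (suc a) =
  trans (cong (indicator (a % 2 ≡ᵇ 0) +_) (countTrue-even a)) (ceilHalf-suc a)

shadedRows-column1 : ∀ n → length (shadedRows (suc n) 1) ≡ ceilHalf n
shadedRows-column1 n =
  trans (length-filter-applyUpTo (λ i → shaded (suc n) i 1) suc n) (countTrue-even n)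

filter-cong : ∀ (f g : ℕ → Bool) → (∀ x → f x ≡ g x) → ∀ xs →
  filter (λ i → f i Data.Bool.≟ true) xs ≡ filter (λ i → g i Data.Bool.≟ true) xs
filter-cong f g f≗g [] = refl
filter-cong f g f≗g (x ∷ xs) rewrite f≗g x with g x
... | true  = cong (x ∷_) (filter-cong f g f≗g xs)
... | false = filter-cong f g f≗g xs

-- Shading depends only on n - i - j, which is invariant under (n,j) ↦ (n+1,j+1).
shaded-shift : ∀ n j i → shaded (suc n) i (suc j) ≡ shaded n i j
shaded-shift n j i = cong (λ v → v % 2 ≡ᵇ 0) (begin
    suc n ∸ i ∸ suc j   ≡⟨ ∸-+-assoc (suc n) i (suc j) ⟩
    suc n ∸ (i + suc j) ≡⟨ cong (suc n ∸_) (+-suc i j) ⟩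
    n ∸ (i + j)         ≡⟨ sym (∸-+-assoc n i j) ⟩
    n ∸ i ∸ j           ∎)
  where open ≡-Reasoning

shadedRows-shift : ∀ n j → shadedRows (suc n) (suc j) ≡ shadedRows n j
shadedRows-shift n j =
  filter-cong (λ i → shaded (suc n) i (suc j)) (λ i → shaded n i j) (shaded-shift n j)
              (applyUpTo suc (n ∸ j))

placementsFrom-shift : ∀ n j m → placementsFrom (suc n) (suc j) m ≡ placementsFrom n j m
placementsFrom-shift n j zero = refl
placementsFrom-shift n j (suc m)
  rewrite placementsFrom-shift n (suc j) m | shadedRows-shift n j = refl

count : ℕ → List Placement → ℕ
count r Ps = length (filter (λ p → rookCount p ≟ r) Ps)

-- Number of placements carrying r - 1 rooks (none when r = 0): these are
-- the ones that become r-rook placements after adding a rook in front.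
countOneFewer : ℕ → List Placement → ℕ
countOneFewer zero    Ps = 0
countOneFewer (suc r) Ps = count r Ps

count-++ : ∀ r Ps Qs → count r (Ps ++ Qs) ≡ count r Ps + count r Qs
count-++ r Ps Qs =
  trans (cong length (filter-++ (λ p → rookCount p ≟ r) Ps Qs))
        (length-++ (filter (λ p → rookCount p ≟ r) Ps))

count-empty-column : ∀ r Ps → count r (map (nothing ∷_) Ps) ≡ count r Ps
count-empty-column r [] = refl
count-empty-column r (p ∷ Ps) with does (rookCount p ≟ r)
... | true  = cong suc (count-empty-column r Ps)
... | false = count-empty-column r Ps

count-rook-column : ∀ r i Ps → count r (map (just i ∷_) Ps) ≡ countOneFewer r Ps
count-rook-column zero    i []       = refl
count-rook-column zero    i (p ∷ Ps) = count-rook-column zero i Ps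
count-rook-column (suc r) i []       = refl
count-rook-column (suc r) i (p ∷ Ps) with does (rookCount p ≟ r)
... | true  = cong suc (count-rook-column (suc r) i Ps)
... | false = count-rook-column (suc r) i Ps

count-rook-rows : ∀ r rows Ps →
  count r (concat (map (λ c → map (c ∷_) Ps) (map just rows))) ≡ length rows * countOneFewer r Ps
count-rook-rows r []         Ps = refl
count-rook-rows r (i ∷ rows) Ps =
  trans (count-++ r (map (just i ∷_) Ps) _)
        (cong₂ _+_ (count-rook-column r i Ps) (count-rook-rows r rows Ps))

count-placementsFrom : ∀ r n j m →
  count r (placementsFrom n j (suc m))
    ≡ count r (placementsFrom n (suc j) m)
      + length (shadedRows n j) * countOneFewer r (placementsFrom n (suc j) m)
count-placementsFrom r n j m =
  trans (count-++ r (map (nothing ∷_) Ps) _)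
        (cong₂ _+_ (count-empty-column r Ps) (count-rook-rows r (shadedRows n j) Ps))
  where Ps = placementsFrom n (suc j) m

AR-oneFewer : ℕ → ℕ → ℕ
AR-oneFewer n zero    = 0
AR-oneFewer n (suc r) = AR-card n r

AR-step : ∀ n r → AR-card (suc n) r ≡ AR-card n r + ceilHalf n * AR-oneFewer n r
AR-step zero    zero    = refl
AR-step zero    (suc r) = refl
AR-step (suc n) r =
  trans (count-placementsFrom r (suc (suc n)) 1 n)
        (cong₂ _+_ (cong (count r) remaining-board)
                   (cong₂ _*_ (shadedRows-column1 (suc n)) (oneFewer r)))
  where
  remaining-board : placementsFrom (suc (suc n)) 2 n ≡ allPlacements (suc n)
  remaining-board = placementsFrom-shift (suc n) 1 n

  oneFewer : ∀ r → countOneFewer r (placementsFrom (suc (suc n)) 2 n) ≡ AR-oneFewer (suc n) r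
  oneFewer zero    = refl
  oneFewer (suc r) = cong (count r) remaining-board

AR-none : ∀ n → AR-card n 0 ≡ 1
AR-none zero    = refl
AR-none (suc n) = trans (AR-step n 0) (cong₂ _+_ (AR-none n) (*-zeroʳ (ceilHalf n)))

-- The board of length n has n - 1 columns, so it carries at most n - 1 rooks.
AR-tooMany : ∀ n r → n ≤ suc r → AR-card n (suc r) ≡ 0
AR-tooMany zero          r       _         = refl
AR-tooMany (suc zero)    r       _         = refl
AR-tooMany (suc (suc n)) (suc r) (s≤s n≤r) = begin
    AR-card (suc (suc n)) (suc (suc r))
  ≡⟨ AR-step (suc n) (suc (suc r)) ⟩
    AR-card (suc n) (suc (suc r)) + ceilHalf (suc n) * AR-card (suc n) (suc r)
  ≡⟨ cong₂ _+_ (AR-tooMany (suc n) (suc r) (≤-trans n≤r (n≤1+n _)))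
               (cong (ceilHalf (suc n) *_) (AR-tooMany (suc n) r n≤r)) ⟩
    ceilHalf (suc n) * 0
  ≡⟨ *-zeroʳ (ceilHalf (suc n)) ⟩
    0
  ∎
  where open ≡-Reasoning

d-≤ : ∀ n k → k ≤ n → d n k ≡ AR-card n (n ∸ k)
d-≤ n k k≤n with k ≤ᵇ n | ≤⇒≤ᵇ k≤n
... | true | _ = refl

d-> : ∀ n k → n < k → d n k ≡ 0
d-> n k n<k with k ≤ᵇ n in k≤ᵇn
... | false = refl
... | true  = contradiction (≤ᵇ⇒≤ k n (subst T (sym k≤ᵇn) tt)) (<⇒≱ n<k)

d-suc : ∀ n k → k ≤ n → d n (suc k) ≡ AR-oneFewer n (n ∸ k)
d-suc n k k≤n with m≤n⇒m<n∨m≡n k≤n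
... | inj₁ k<n = trans (d-≤ n (suc k) k<n) (cong (AR-oneFewer n) (sym (+-∸-assoc 1 k<n)))
... | inj₂ refl rewrite n∸n≡0 n = d-> n (suc n) ≤-refl

proposition7p6 : ((n k : ℕ) → 1 ≤ n → 1 ≤ k → k ≤ n →
    d n k ≡ d (n ∸ 1) (k ∸ 1) + ceilHalf (n ∸ 1) * d (n ∸ 1) k)
    × ((n : ℕ) → d n 0 ≡ δ n 0)
    × ((n : ℕ) → d n n ≡ 1)
    × ((n k : ℕ) → n < k → d n k ≡ 0)
proposition7p6 = recurrence , column0 , diagonal , d->
  where
  recurrence : (n k : ℕ) → 1 ≤ n → 1 ≤ k → k ≤ n →
    d n k ≡ d (n ∸ 1) (k ∸ 1) + ceilHalf (n ∸ 1) * d (n ∸ 1) k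
  recurrence (suc n) (suc k) _ _ (s≤s k≤n) = begin
      d (suc n) (suc k)
    ≡⟨ d-≤ (suc n) (suc k) (s≤s k≤n) ⟩
      AR-card (suc n) (n ∸ k)
    ≡⟨ AR-step n (n ∸ k) ⟩
      AR-card n (n ∸ k) + ceilHalf n * AR-oneFewer n (n ∸ k)
    ≡⟨ sym (cong₂ _+_ (d-≤ n k k≤n) (cong (ceilHalf n *_) (d-suc n k k≤n))) ⟩
      d n k + ceilHalf n * d n (suc k)
    ∎
    where open ≡-Reasoning

  column0 : (n : ℕ) → d n 0 ≡ δ n 0
  column0 zero    = refl
  column0 (suc n) = trans (d-≤ (suc n) 0 z≤n) (AR-tooMany (suc n) n ≤-refl)

  diagonal : (n : ℕ) → d n n ≡ 1
  diagonal n = trans (d-≤ n n ≤-refl) (trans (cong (AR-card n) (n∸n≡0 n)) (AR-none n))
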